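{- Let $S$ be a rooted plane tree with $m$ vertices and degree distribution sequence $d_S=(l,u,d_2,\dots,d_{m-1})$, and let $G_S(z)=\sum_{n\ge0} g_{\mathcal{B}_n}(S)z^n$ be the generating function of the number of good embeddings of $S$ into $\mathcal{B}_n$. Then $G_S(z)=(1-2zB(z))A_S(z)$, where $A_S(z)=\sum_{n\ge 0}a_{\mathcal{B}_n}(S)z^n$ and $B(z)=\frac{1-\sqrt{1-4z^2}}{2z}$.
   Context: A plane binary tree is a rooted tree in which every node has $0$ or $2$ ordered children; its size is its number of nodes and $\mathcal{B}_n$ is the set of plane binary trees with $n$ nodes; $B(z)$ is their generating function by number of nodes. A rooted plane tree has linearly ordered children at each node (arbitrary out-degrees). Trees are viewed as posets with $x\le y$ iff $y$ is an ancestor of $x$ (each vertex is its own ancestor). For plane rooted trees $S,T$, an embedding of $S$ into $T$ is a set $X$ of vertices of $T$ with a bijection $\varphi:V(S)\to X$ such that $x$ is an ancestor of $y$ in $S$ iff $\varphi(x)$ is an ancestor of $\varphi(y)$ in $T$, and whenever $y_1$ precedes $y_2$ (left to right) among the children of a node of $S$, then at the last common ancestor $w$ of $\varphi(y_1),\varphi(y_2)$ in $T$ the child of $w$ towards $\varphi(y_1)$ lies to the left of the child towards $\varphi(y_2)$. An embedding is good if $X$ contains the root of $T$. $a_{\mathcal{B}_n}(S)$ (resp. $g_{\mathcal{B}_n}(S)$) is the total number of embeddings (resp. good embeddings) of $S$ into all trees of $\mathcal{B}_n$. The degree distribution sequence $(d_0,\dots,d_{m-1})$ records the number $d_i$ of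 vertices with $i$ children; $l=d_0$, $u=d_1$. -}

module Defs where

open import Data.Nat using (ℕ; zero; suc; _+_; _*_; _∸_; _<ᵇ_; _≡ᵇ_)
open import Data.Bool using (Bool; true; false; _∧_; _∨_; not; if_then_else_)
open import Data.List using (List; []; _∷_; _++_; map; concatMap; length; filterᵇ; null; upTo)
open import Data.Bool.ListAction using (all; any)
open import Data.Nat.ListAction using (sum)
open import Data.Product using (_×_; _,_)

data PTree : Set where
  node : List PTree → PTree

-- A vertex is addressed by its path from the root: the list of child
-- indices (0-based, left to right).  The root is [].
Addr : Set
Addr = List ℕ

mutual
  vertices : PTree → List Addr
  vertices (node ts) = [] ∷ childVerts 0 ts

  childVerts : ℕ → List PTree → List Addr
  childVerts i []       = []
  childVerts i (t ∷ ts) = map (i ∷_) (vertices t) ++ childVerts (suc i) ts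

data BTree : Set where
  leaf : BTree
  bin  : BTree → BTree → BTree

size : BTree → ℕ
size leaf      = 1
size (bin l r) = suc (size l + size r)

toPTree : BTree → PTree
toPTree leaf      = node []
toPTree (bin l r) = node (toPTree l ∷ toPTree r ∷ [])

treesDepth : ℕ → List BTree
treesDepth zero    = leaf ∷ []
treesDepth (suc d) = leaf ∷ concatMap (λ l → map (bin l) (treesDepth d)) (treesDepth d)

-- 𝓑 n : all plane binary trees with n nodes (such a tree has depth < n)
𝓑 : ℕ → List BTree
𝓑 n = filterᵇ (λ t → size t ≡ᵇ n) (treesDepth n)

-- b n = |𝓑 n|, the coefficients of B(z)
b : ℕ → ℕ
b n = length (𝓑 n)

-- x is an ancestor of y (each vertex is its own ancestor): prefix of addresses
isAnc : Addr → Addr → Bool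
isAnc []       y        = true
isAnc (i ∷ x)  []       = false
isAnc (i ∷ x)  (j ∷ y)  = (i ≡ᵇ j) ∧ isAnc x y

eqAddr : Addr → Addr → Bool
eqAddr x y = isAnc x y ∧ isAnc y x

leftSibling : Addr → Addr → Bool
leftSibling (i ∷ [])        (j ∷ [])        = i <ᵇ j
leftSibling (i ∷ x@(_ ∷ _)) (j ∷ y@(_ ∷ _)) = (i ≡ᵇ j) ∧ leftSibling x y
leftSibling _               _               = false

-- at the last common ancestor w of a and b, the child of w towards a lies
-- to the left of the child of w towards b
leftOf : Addr → Addr → Bool
leftOf []      _       = false
leftOf (_ ∷ _) []      = false
leftOf (i ∷ a) (j ∷ c) = (i <ᵇ j) ∨ ((i ≡ᵇ j) ∧ leftOf a c)

-- A candidate map φ : V(S) → V(T), as an association list pairing each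
-- vertex of S with its image.
Map : Set
Map = List (Addr × Addr)

allMaps : List Addr → List Addr → List Map
allMaps []       ys = [] ∷ []
allMaps (x ∷ xs) ys = concatMap (λ y → map ((x , y) ∷_) (allMaps xs ys)) ys

isEmbedding : Map → Bool
isEmbedding φ =
  all (λ { (x , a) → all (λ { (y , c) →
        (isAnc x y ∧ isAnc a c ∨ not (isAnc x y) ∧ not (isAnc a c))
        ∧ (not (leftSibling x y) ∨ leftOf a c) }) φ }) φ

isGood : Map → Bool
isGood φ = any (λ { (x , a) → null a }) φ

embeddings : PTree → PTree → List Map
embeddings S T = filterᵇ isEmbedding (allMaps (vertices S) (vertices T))

emb : PTree → PTree → ℕ
emb S T = length (embeddings S T)

goodEmb : PTree → PTree → ℕ
goodEmb S T = length (filterᵇ isGood (embeddings S T))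

a𝓑 : PTree → ℕ → ℕ
a𝓑 S n = sum (map (λ t → emb S (toPTree t)) (𝓑 n))

g𝓑 : PTree → ℕ → ℕ
g𝓑 S n = sum (map (λ t → goodEmb S (toPTree t)) (𝓑 n))

-- Coefficients of z·B(z):  [z^0] = 0,  [z^(k+1)] = b k
zB : ℕ → ℕ
zB zero    = 0
zB (suc k) = b k

zBA : PTree → ℕ → ℕ
zBA S n = sum (map (λ k → zB k * a𝓑 S (n ∸ k)) (upTo (suc n)))

module Submission where

-- An embedding of S into a binary tree T is either good or sends the root of S strictly below the
-- root of T.  In the latter case the image of the root of S, being an ancestor of every image, lies
-- in one of the two root subtrees of T = bin l r, and so does the whole embedding; conversely every
-- embedding into l or r is such a bad embedding.  Hence emb S T = goodEmb S T + emb S l + emb S r,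
-- and summing over 𝓑 (m+1) splits by the sizes i + (m - i) of l and r into
-- Σᵢ (b (m-i) · a i + b i · a (m-i)) = 2 [zᵐ⁺¹] z B(z) A_S(z).

open import Defs
open import Algebra.Properties.CommutativeSemigroup using (interchange)
open import Data.Bool using (Bool; true; false; _∧_; _∨_; not; if_then_else_; T; T?)
open import Data.Bool.ListAction using (all)
open import Data.Bool.Properties using (∧-identityʳ; if-eta; T-∧)
open import Data.Empty using (⊥; ⊥-elim)
open import Data.List using (List; []; _∷_; _++_; map; concatMap; length; filterᵇ; upTo)
open import Data.List.Properties using (map-cong; map-++; map-∘; map-upTo; map-applyUpTo; upTo-∷ʳ; length-++; filter-++)
open import Data.List.Relation.Unary.All as All using (All; []; _∷_)
open import Data.List.Relation.Unary.All.Properties using (all⁺)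
open import Data.Nat using (ℕ; zero; suc; _+_; _*_; _∸_; _<ᵇ_; _≡ᵇ_; _≤_; _<_; _≤′_; ≤′-refl; ≤′-step; z≤n; s≤s)
open import Data.Nat.ListAction using (sum)
open import Data.Nat.ListAction.Properties using (sum-++)
open import Data.Nat.Properties
open import Data.Product using (_×_; _,_; proj₁; proj₂)
open import Function using (_∘_; Equivalence)
open import Relation.Nullary using (¬_)
open import Relation.Binary.PropositionalEquality using (_≡_; refl; sym; trans; cong; cong₂; module ≡-Reasoning)

module _ {A : Set} where

  ∑ : List A → (A → ℕ) → ℕ
  ∑ xs f = sum (map f xs)

  infix 6.5 ∑
  syntax ∑ xs (λ x → e) = ∑[ x ∈ xs ] e

  ∑-cong : ∀ {f g : A → ℕ} → (∀ x → f x ≡ g x) → ∀ xs → ∑ xs f ≡ ∑ xs g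
  ∑-cong f≗g xs = cong sum (map-cong f≗g xs)

  ∑-zero : ∀ {f : A → ℕ} → (∀ x → f x ≡ 0) → ∀ xs → ∑ xs f ≡ 0
  ∑-zero f≗0 []       = refl
  ∑-zero f≗0 (x ∷ xs) = cong₂ _+_ (f≗0 x) (∑-zero f≗0 xs)

  ∑-++ : ∀ (f : A → ℕ) xs ys → ∑ (xs ++ ys) f ≡ ∑ xs f + ∑ ys f
  ∑-++ f xs ys = trans (cong sum (map-++ f xs ys)) (sum-++ (map f xs) (map f ys))

  ∑-+ : ∀ (f g : A → ℕ) xs → ∑[ x ∈ xs ] (f x + g x) ≡ ∑ xs f + ∑ xs g
  ∑-+ f g []       = refl
  ∑-+ f g (x ∷ xs) = trans (cong (f x + g x +_) (∑-+ f g xs))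
                           (interchange +-commutativeSemigroup (f x) (g x) (∑ xs f) (∑ xs g))

  ∑-*ˡ : ∀ c (f : A → ℕ) xs → ∑[ x ∈ xs ] (c * f x) ≡ c * ∑ xs f
  ∑-*ˡ c f []       = sym (*-zeroʳ c)
  ∑-*ˡ c f (x ∷ xs) = trans (cong (c * f x +_) (∑-*ˡ c f xs)) (sym (*-distribˡ-+ c (f x) (∑ xs f)))

  ∑-const : ∀ c xs → ∑[ x ∈ xs ] c ≡ length xs * c
  ∑-const c []       = refl
  ∑-const c (x ∷ xs) = cong (c +_) (∑-const c xs)

  ∑-if : ∀ b (f : A → ℕ) xs → ∑[ x ∈ xs ] (if b then f x else 0) ≡ (if b then ∑ xs f else 0)
  ∑-if true  f xs = refl
  ∑-if false f xs = ∑-zero (λ _ → refl) xs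

  ∑-filterᵇ : ∀ (p : A → Bool) (f : A → ℕ) xs → ∑ (filterᵇ p xs) f ≡ ∑[ x ∈ xs ] (if p x then f x else 0)
  ∑-filterᵇ p f []       = refl
  ∑-filterᵇ p f (x ∷ xs) with p x
  ... | true  = cong (f x +_) (∑-filterᵇ p f xs)
  ... | false = ∑-filterᵇ p f xs

module _ {A B : Set} where

  ∑-map : ∀ (f : B → ℕ) (h : A → B) xs → ∑ (map h xs) f ≡ ∑ xs (f ∘ h)
  ∑-map f h xs = cong sum (sym (map-∘ xs))

  ∑-concatMap : ∀ (f : B → ℕ) (k : A → List B) xs → ∑ (concatMap k xs) f ≡ ∑[ x ∈ xs ] ∑ (k x) f
  ∑-concatMap f k []       = refl
  ∑-concatMap f k (x ∷ xs) = trans (∑-++ f (k x) (concatMap k xs)) (cong (∑ (k x) f +_) (∑-concatMap f k xs))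

  ∑-comm : ∀ (F : A → B → ℕ) xs ys → ∑[ x ∈ xs ] ∑[ y ∈ ys ] F x y ≡ ∑[ y ∈ ys ] ∑[ x ∈ xs ] F x y
  ∑-comm F []       ys = sym (∑-zero (λ _ → refl) ys)
  ∑-comm F (x ∷ xs) ys = trans (cong (∑ ys (F x) +_) (∑-comm F xs ys))
                               (sym (∑-+ (F x) (λ y → ∑[ x ∈ xs ] F x y) ys))

  ∑∑-+ : ∀ (f : A → ℕ) (g : B → ℕ) xs ys →
    ∑[ x ∈ xs ] ∑[ y ∈ ys ] (f x + g y) ≡ length ys * ∑ xs f + length xs * ∑ ys g
  ∑∑-+ f g xs ys = begin
    ∑[ x ∈ xs ] ∑[ y ∈ ys ] (f x + g y)        ≡⟨ ∑-cong (λ x → ∑-+ (λ _ → f x) g ys) xs ⟩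
    ∑[ x ∈ xs ] (∑[ y ∈ ys ] f x + ∑ ys g)     ≡⟨ ∑-cong (λ x → cong (_+ ∑ ys g) (∑-const (f x) ys)) xs ⟩
    ∑[ x ∈ xs ] (length ys * f x + ∑ ys g)     ≡⟨ ∑-+ (λ x → length ys * f x) (λ _ → ∑ ys g) xs ⟩
    ∑[ x ∈ xs ] length ys * f x + ∑[ x ∈ xs ] ∑ ys g
                                               ≡⟨ cong₂ _+_ (∑-*ˡ (length ys) f xs) (∑-const (∑ ys g) xs) ⟩
    length ys * ∑ xs f + length xs * ∑ ys g    ∎
    where open ≡-Reasoning

∑-upTo-suc : ∀ (F : ℕ → ℕ) n → ∑ (upTo (suc n)) F ≡ F 0 + ∑[ i ∈ upTo n ] F (suc i)
∑-upTo-suc F n = cong (F 0 +_) (cong sum (trans (map-applyUpTo suc F n) (sym (map-upTo (F ∘ suc) n))))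

∑-upTo-∷ʳ : ∀ (F : ℕ → ℕ) n → ∑ (upTo (suc n)) F ≡ ∑ (upTo n) F + F n
∑-upTo-∷ʳ F n = begin
  ∑ (upTo (suc n)) F          ≡⟨ cong (λ is → ∑ is F) (upTo-∷ʳ n) ⟨
  ∑ (upTo n ++ n ∷ []) F      ≡⟨ ∑-++ F (upTo n) (n ∷ []) ⟩
  ∑ (upTo n) F + (F n + 0)    ≡⟨ cong (∑ (upTo n) F +_) (+-identityʳ (F n)) ⟩
  ∑ (upTo n) F + F n          ∎
  where open ≡-Reasoning

∑-upTo-cong : ∀ n {F G : ℕ → ℕ} → (∀ i → i < n → F i ≡ G i) → ∑ (upTo n) F ≡ ∑ (upTo n) G
∑-upTo-cong zero    F≗G = refl
∑-upTo-cong (suc n) {F} {G} F≗G = begin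
  ∑ (upTo (suc n)) F                 ≡⟨ ∑-upTo-suc F n ⟩
  F 0 + ∑[ i ∈ upTo n ] F (suc i)    ≡⟨ cong₂ _+_ (F≗G 0 (s≤s z≤n)) (∑-upTo-cong n (λ i i<n → F≗G (suc i) (s≤s i<n))) ⟩
  G 0 + ∑[ i ∈ upTo n ] G (suc i)    ≡⟨ ∑-upTo-suc G n ⟨
  ∑ (upTo (suc n)) G                 ∎
  where open ≡-Reasoning

∑-upTo-reverse : ∀ n (F : ℕ → ℕ) → ∑[ i ∈ upTo (suc n) ] F (n ∸ i) ≡ ∑ (upTo (suc n)) F
∑-upTo-reverse zero    F = refl
∑-upTo-reverse (suc n) F = begin
  ∑[ i ∈ upTo (suc (suc n)) ] F (suc n ∸ i)   ≡⟨ ∑-upTo-suc (λ i → F (suc n ∸ i)) (suc n) ⟩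
  F (suc n) + ∑[ i ∈ upTo (suc n) ] F (n ∸ i) ≡⟨ cong (F (suc n) +_) (∑-upTo-reverse n F) ⟩
  F (suc n) + ∑ (upTo (suc n)) F              ≡⟨ +-comm (F (suc n)) _ ⟩
  ∑ (upTo (suc n)) F + F (suc n)              ≡⟨ ∑-upTo-∷ʳ F (suc n) ⟨
  ∑ (upTo (suc (suc n))) F                    ∎
  where open ≡-Reasoning

∑-upTo-select : ∀ N s (H : ℕ → ℕ) → ∑[ i ∈ upTo N ] (if s ≡ᵇ i then H i else 0) ≡ (if s <ᵇ N then H s else 0)
∑-upTo-select zero    s       H = refl
∑-upTo-select (suc N) zero    H = trans (∑-upTo-suc (λ i → if 0 ≡ᵇ i then H i else 0) N)
  (trans (cong (H 0 +_) (∑-zero (λ _ → refl) (upTo N))) (+-identityʳ (H 0)))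
∑-upTo-select (suc N) (suc s) H = trans (∑-upTo-suc (λ i → if suc s ≡ᵇ i then H i else 0) N)
  (∑-upTo-select N s (H ∘ suc))

if-+≡ᵇ : ∀ s t j (X : ℕ) → (if s + t ≡ᵇ j then X else 0) ≡ (if s <ᵇ suc j then (if t ≡ᵇ j ∸ s then X else 0) else 0)
if-+≡ᵇ zero    t j       X = refl
if-+≡ᵇ (suc s) t zero    X = refl
if-+≡ᵇ (suc s) t (suc j) X = if-+≡ᵇ s t j X

∑∑-by-size : ∀ {A B : Set} (sA : A → ℕ) (sB : B → ℕ) (xs : List A) (ys : List B) j (F : A → B → ℕ) →
  ∑[ x ∈ xs ] ∑[ y ∈ ys ] (if sA x + sB y ≡ᵇ j then F x y else 0)
  ≡ ∑[ i ∈ upTo (suc j) ] ∑[ x ∈ xs ] (if sA x ≡ᵇ i then ∑[ y ∈ ys ] (if sB y ≡ᵇ j ∸ i then F x y else 0) else 0)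
∑∑-by-size {A} {B} sA sB xs ys j F = begin
  ∑[ x ∈ xs ] ∑[ y ∈ ys ] (if sA x + sB y ≡ᵇ j then F x y else 0)
    ≡⟨ ∑-cong (λ x → ∑-cong (λ y → split x y) ys) xs ⟩
  ∑[ x ∈ xs ] ∑[ y ∈ ys ] ∑[ i ∈ upTo (suc j) ] G x y i
    ≡⟨ ∑-cong (λ x → ∑-comm (G x) ys (upTo (suc j))) xs ⟩
  ∑[ x ∈ xs ] ∑[ i ∈ upTo (suc j) ] ∑[ y ∈ ys ] G x y i
    ≡⟨ ∑-comm (λ x i → ∑[ y ∈ ys ] G x y i) xs (upTo (suc j)) ⟩
  ∑[ i ∈ upTo (suc j) ] ∑[ x ∈ xs ] ∑[ y ∈ ys ] G x y i
    ≡⟨ ∑-cong (λ i → ∑-cong (λ x → ∑-if (sA x ≡ᵇ i) _ ys) xs) (upTo (suc j)) ⟩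
  ∑[ i ∈ upTo (suc j) ] ∑[ x ∈ xs ] (if sA x ≡ᵇ i then ∑[ y ∈ ys ] (if sB y ≡ᵇ j ∸ i then F x y else 0) else 0)
    ∎
  where
  open ≡-Reasoning
  G : A → B → ℕ → ℕ
  G x y i = if sA x ≡ᵇ i then (if sB y ≡ᵇ j ∸ i then F x y else 0) else 0
  split : ∀ x y → (if sA x + sB y ≡ᵇ j then F x y else 0) ≡ ∑[ i ∈ upTo (suc j) ] G x y i
  split x y = trans (if-+≡ᵇ (sA x) (sB y) j (F x y))
                    (sym (∑-upTo-select (suc j) (sA x) (λ i → if sB y ≡ᵇ j ∸ i then F x y else 0)))

sizeSum : ℕ → ℕ → (BTree → ℕ) → ℕ
sizeSum d j f = ∑[ t ∈ treesDepth d ] (if size t ≡ᵇ j then f t else 0)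

∑-𝓑 : ∀ n f → ∑ (𝓑 n) f ≡ sizeSum n n f
∑-𝓑 n f = ∑-filterᵇ (λ t → size t ≡ᵇ n) f (treesDepth n)

sizeSum-zero : ∀ d f → sizeSum d 0 f ≡ 0
sizeSum-zero d f = ∑-zero (λ { leaf → refl ; (bin l r) → refl }) (treesDepth d)

sizeSum-cong : ∀ d j {f g : BTree → ℕ} → (∀ t → f t ≡ g t) → sizeSum d j f ≡ sizeSum d j g
sizeSum-cong d j f≗g = ∑-cong (λ t → cong (if size t ≡ᵇ j then_else 0) (f≗g t)) (treesDepth d)

sizeSum-suc : ∀ d j f → sizeSum (suc d) (suc j) f
  ≡ (if 1 ≡ᵇ suc j then f leaf else 0) + ∑[ i ∈ upTo (suc j) ] sizeSum d i (λ l → sizeSum d (j ∸ i) (f ∘ bin l))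
sizeSum-suc d j f = cong ((if 1 ≡ᵇ suc j then f leaf else 0) +_) (begin
  ∑ (concatMap (λ l → map (bin l) (treesDepth d)) (treesDepth d)) g
    ≡⟨ ∑-concatMap g (λ l → map (bin l) (treesDepth d)) (treesDepth d) ⟩
  ∑[ l ∈ treesDepth d ] ∑ (map (bin l) (treesDepth d)) g
    ≡⟨ ∑-cong (λ l → ∑-map g (bin l) (treesDepth d)) (treesDepth d) ⟩
  ∑[ l ∈ treesDepth d ] ∑[ r ∈ treesDepth d ] (if size l + size r ≡ᵇ j then f (bin l r) else 0)
    ≡⟨ ∑∑-by-size size size (treesDepth d) (treesDepth d) j (λ l r → f (bin l r)) ⟩
  ∑[ i ∈ upTo (suc j) ] sizeSum d i (λ l → sizeSum d (j ∸ i) (f ∘ bin l))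
    ∎)
  where
  open ≡-Reasoning
  g : BTree → ℕ
  g t = if size t ≡ᵇ suc j then f t else 0

-- A tree of size j has depth below j, so deepening the enumeration beyond j adds nothing.
sizeSum-deepen : ∀ d j f → j ≤ d → sizeSum (suc d) j f ≡ sizeSum d j f
sizeSum-deepen d       zero    f _ = trans (sizeSum-zero (suc d) f) (sym (sizeSum-zero d f))
sizeSum-deepen (suc d) (suc j) f (s≤s j≤d) = begin
  sizeSum (suc (suc d)) (suc j) f
    ≡⟨ sizeSum-suc (suc d) j f ⟩
  leafTerm + ∑[ i ∈ upTo (suc j) ] sizeSum (suc d) i (λ l → sizeSum (suc d) (j ∸ i) (f ∘ bin l))
    ≡⟨ cong (leafTerm +_) (∑-upTo-cong (suc j) deepen-both) ⟩
  leafTerm + ∑[ i ∈ upTo (suc j) ] sizeSum d i (λ l → sizeSum d (j ∸ i) (f ∘ bin l))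
    ≡⟨ sizeSum-suc d j f ⟨
  sizeSum (suc d) (suc j) f
    ∎
  where
  open ≡-Reasoning
  leafTerm : ℕ
  leafTerm = if 1 ≡ᵇ suc j then f leaf else 0
  deepen-both : ∀ i → i < suc j → sizeSum (suc d) i (λ l → sizeSum (suc d) (j ∸ i) (f ∘ bin l))
                                ≡ sizeSum d i (λ l → sizeSum d (j ∸ i) (f ∘ bin l))
  deepen-both i (s≤s i≤j) =
    trans (sizeSum-cong (suc d) i (λ l → sizeSum-deepen d (j ∸ i) (f ∘ bin l) (≤-trans (m∸n≤m j i) j≤d)))
          (sizeSum-deepen d i _ (≤-trans i≤j j≤d))

sizeSum-stable : ∀ {d j} f → j ≤′ d → sizeSum d j f ≡ sizeSum j j f
sizeSum-stable f ≤′-refl = refl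
sizeSum-stable {suc d} {j} f (≤′-step j≤′d) = trans (sizeSum-deepen d j f (≤′⇒≤ j≤′d)) (sizeSum-stable f j≤′d)

∑-𝓑-suc : ∀ m f → ∑ (𝓑 (suc m)) f
  ≡ (if 1 ≡ᵇ suc m then f leaf else 0) + ∑[ i ∈ upTo (suc m) ] ∑[ l ∈ 𝓑 i ] ∑[ r ∈ 𝓑 (m ∸ i) ] f (bin l r)
∑-𝓑-suc m f = trans (∑-𝓑 (suc m) f) (trans (sizeSum-suc m m f)
  (cong ((if 1 ≡ᵇ suc m then f leaf else 0) +_) (∑-upTo-cong (suc m) split-sizes)))
  where
  stable : ∀ {j} g → j ≤ m → sizeSum m j g ≡ ∑ (𝓑 j) g
  stable {j} g j≤m = trans (sizeSum-stable g (≤⇒≤′ j≤m)) (sym (∑-𝓑 j g))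
  split-sizes : ∀ i → i < suc m → sizeSum m i (λ l → sizeSum m (m ∸ i) (f ∘ bin l))
                                ≡ ∑[ l ∈ 𝓑 i ] ∑[ r ∈ 𝓑 (m ∸ i) ] f (bin l r)
  split-sizes i (s≤s i≤m) = trans (sizeSum-cong m i (λ l → stable (f ∘ bin l) (m∸n≤m m i))) (stable _ i≤m)

module _ {A : Set} where

  count : (A → Bool) → List A → ℕ
  count p xs = length (filterᵇ p xs)

  count-++ : ∀ (p : A → Bool) xs ys → count p (xs ++ ys) ≡ count p xs + count p ys
  count-++ p xs ys = trans (cong length (filter-++ (T? ∘ p) xs ys)) (length-++ (filterᵇ p xs))

  count-cong : ∀ {p q : A → Bool} → (∀ x → p x ≡ q x) → ∀ xs → count p xs ≡ count q xs
  count-cong p≗q [] = refl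
  count-cong {p} {q} p≗q (x ∷ xs) with p x | q x | p≗q x
  ... | true  | .true  | refl = cong suc (count-cong p≗q xs)
  ... | false | .false | refl = count-cong p≗q xs

  count-none : ∀ {p : A → Bool} → (∀ x → ¬ T (p x)) → ∀ xs → count p xs ≡ 0
  count-none ¬p [] = refl
  count-none {p} ¬p (x ∷ xs) with p x | ¬p x
  ... | true  | ¬t = ⊥-elim (¬t _)
  ... | false | _  = count-none ¬p xs

  count-filterᵇ : ∀ (p q : A → Bool) xs → count q (filterᵇ p xs) ≡ count (λ x → p x ∧ q x) xs
  count-filterᵇ p q [] = refl
  count-filterᵇ p q (x ∷ xs) with p x
  ... | false = count-filterᵇ p q xs
  ... | true with q x
  ...   | true  = cong suc (count-filterᵇ p q xs)
  ...   | false = count-filterᵇ p q xs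

  length≡count+count-not : ∀ (p : A → Bool) xs → length xs ≡ count p xs + count (not ∘ p) xs
  length≡count+count-not p [] = refl
  length≡count+count-not p (x ∷ xs) with p x
  ... | true  = cong suc (length≡count+count-not p xs)
  ... | false = trans (cong suc (length≡count+count-not p xs)) (sym (+-suc _ _))

module _ {A B : Set} where

  count-map : ∀ (p : B → Bool) (h : A → B) xs → count p (map h xs) ≡ count (p ∘ h) xs
  count-map p h [] = refl
  count-map p h (x ∷ xs) with p (h x)
  ... | true  = cong suc (count-map p h xs)
  ... | false = count-map p h xs

  count-concatMap : ∀ (p : B → Bool) (k : A → List B) xs → count p (concatMap k xs) ≡ ∑[ x ∈ xs ] count p (k x)
  count-concatMap p k []       = refl
  count-concatMap p k (x ∷ xs) = trans (count-++ p (k x) (concatMap k xs)) (cong (count p (k x) +_) (count-concatMap p k xs))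

count-allMaps-∷ : ∀ (P : Map → Bool) x xs ys →
  count P (allMaps (x ∷ xs) ys) ≡ ∑[ y ∈ ys ] count (λ φ → P ((x , y) ∷ φ)) (allMaps xs ys)
count-allMaps-∷ P x xs ys = trans (count-concatMap P (λ y → map ((x , y) ∷_) (allMaps xs ys)) ys)
                                  (∑-cong (λ y → count-map P ((x , y) ∷_) (allMaps xs ys)) ys)

Below : ℕ → Addr → Set
Below c []      = ⊥
Below c (d ∷ _) = c ≡ d

-- Encodes that the addresses of ys lying below child c are exactly c ∷ a for a ∈ as, each listed once.
IsBranch : ℕ → List Addr → List Addr → Set
IsBranch c ys as = ∀ (F : Addr → ℕ) → (∀ y → ¬ Below c y → F y ≡ 0) → ∑ ys F ≡ ∑[ a ∈ as ] F (c ∷ a)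

underChild : ℕ → Addr × Addr → Addr × Addr
underChild c (x , a) = x , c ∷ a

count-allMaps-branch : ∀ c ys as → IsBranch c ys as → ∀ xs (P : Map → Bool) →
  (∀ φ → T (P φ) → All (Below c ∘ proj₂) φ) →
  count P (allMaps xs ys) ≡ count (P ∘ map (underChild c)) (allMaps xs as)
count-allMaps-branch c ys as branch []       P inside with P []
... | true  = refl
... | false = refl
count-allMaps-branch c ys as branch (x ∷ xs) P inside = begin
  count P (allMaps (x ∷ xs) ys)
    ≡⟨ count-allMaps-∷ P x xs ys ⟩
  ∑[ y ∈ ys ] count (λ φ → P ((x , y) ∷ φ)) (allMaps xs ys)
    ≡⟨ branch _ (λ y ¬below → count-none (λ φ t → ¬below (All.head (inside _ t))) (allMaps xs ys)) ⟩
  ∑[ a ∈ as ] count (λ φ → P ((x , c ∷ a) ∷ φ)) (allMaps xs ys)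
    ≡⟨ ∑-cong (λ a → count-allMaps-branch c ys as branch xs _ (λ φ t → All.tail (inside _ t))) as ⟩
  ∑[ a ∈ as ] count (λ φ → P ((x , c ∷ a) ∷ map (underChild c) φ)) (allMaps xs as)
    ≡⟨ count-allMaps-∷ (P ∘ map (underChild c)) x xs as ⟨
  count (P ∘ map (underChild c)) (allMaps (x ∷ xs) as)
    ∎
  where open ≡-Reasoning

≡ᵇ-refl : ∀ n → (n ≡ᵇ n) ≡ true
≡ᵇ-refl zero    = refl
≡ᵇ-refl (suc n) = ≡ᵇ-refl n

<ᵇ-irrefl : ∀ n → (n <ᵇ n) ≡ false
<ᵇ-irrefl zero    = refl
<ᵇ-irrefl (suc n) = <ᵇ-irrefl n

isAnc-∷ : ∀ c a b → isAnc (c ∷ a) (c ∷ b) ≡ isAnc a b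
isAnc-∷ c a b rewrite ≡ᵇ-refl c = refl

leftOf-∷ : ∀ c a b → leftOf (c ∷ a) (c ∷ b) ≡ leftOf a b
leftOf-∷ c a b rewrite ≡ᵇ-refl c | <ᵇ-irrefl c = refl

all²-map : ∀ {A B : Set} (h : A → B) (K : B → B → Bool) (K′ : A → A → Bool) →
  (∀ x y → K (h x) (h y) ≡ K′ x y) → ∀ xs →
  all (λ x → all (K x) (map h xs)) (map h xs) ≡ all (λ x → all (K′ x) xs) xs
all²-map h K K′ K∘h≗K′ xs = trans (all-map _ xs) (all-cong (λ x → trans (all-map _ xs) (all-cong (K∘h≗K′ x) xs)) xs)
  where
  all-map : ∀ {A B : Set} (p : B → Bool) {h : A → B} xs → all p (map h xs) ≡ all (p ∘ h) xs
  all-map p []       = refl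
  all-map p (x ∷ xs) = cong (_ ∧_) (all-map p xs)
  all-cong : ∀ {A : Set} {p q : A → Bool} → (∀ x → p x ≡ q x) → ∀ xs → all p xs ≡ all q xs
  all-cong p≗q []       = refl
  all-cong p≗q (x ∷ xs) = cong₂ _∧_ (p≗q x) (all-cong p≗q xs)

compatible : Addr × Addr → Addr × Addr → Bool
compatible (x , a) (y , b) =
  (isAnc x y ∧ isAnc a b ∨ not (isAnc x y) ∧ not (isAnc a b)) ∧ (not (leftSibling x y) ∨ leftOf a b)

compatible-underChild : ∀ c p q → compatible (underChild c p) (underChild c q) ≡ compatible p q
compatible-underChild c (x , a) (y , b) rewrite isAnc-∷ c a b | leftOf-∷ c a b = refl

isEmbedding-underChild : ∀ c φ → isEmbedding (map (underChild c) φ) ≡ isEmbedding φ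
isEmbedding-underChild c φ = all²-map (underChild c) compatible compatible (compatible-underChild c) φ

isBad : Map → Bool
isBad φ = isEmbedding φ ∧ not (isGood φ)

badEmb : PTree → PTree → ℕ
badEmb S T = count isBad (allMaps (vertices S) (vertices T))

emb≡goodEmb+badEmb : ∀ S T → emb S T ≡ goodEmb S T + badEmb S T
emb≡goodEmb+badEmb S T = trans (length≡count+count-not isGood (embeddings S T))
  (cong (goodEmb S T +_) (count-filterᵇ isEmbedding (not ∘ isGood) (allMaps (vertices S) (vertices T))))

isBad-root : ∀ φ → ¬ T (isBad (([] , []) ∷ φ))
isBad-root φ t = proj₂ (Equivalence.to T-∧ t)

isGood-underChild : ∀ c φ → isGood (map (underChild c) φ) ≡ false
isGood-underChild c []            = refl
isGood-underChild c ((x , a) ∷ φ) = isGood-underChild c φ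

isBad-underChild : ∀ c φ → isBad (map (underChild c) φ) ≡ isEmbedding φ
isBad-underChild c φ rewrite isEmbedding-underChild c φ | isGood-underChild c φ = ∧-identityʳ _

-- The root of S lies above every vertex of S, so its image lies above every image.
root-image-isAnc : ∀ a φ → T (isEmbedding (([] , a) ∷ φ)) → All (λ q → T (isAnc a (proj₂ q))) φ
root-image-isAnc a φ t = All.map (λ {q} → ancestor q) (All.tail (all⁺ _ ψ (All.head (all⁺ _ ψ t))))
  where
  ψ : Map
  ψ = ([] , a) ∷ φ
  ancestor : ∀ q → T (compatible ([] , a) q) → T (isAnc a (proj₂ q))
  ancestor (y , b) t with isAnc a b
  ... | true  = _
  ... | false = t

isAnc-∷⇒Below : ∀ c a b → T (isAnc (c ∷ a) b) → Below c b
isAnc-∷⇒Below c a []      ()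
isAnc-∷⇒Below c a (d ∷ b) t = ≡ᵇ⇒≡ c d (proj₁ (Equivalence.to T-∧ t))

isBad-below : ∀ c a φ → T (isBad (([] , c ∷ a) ∷ φ)) → All (Below c ∘ proj₂) φ
isBad-below c a φ t =
  All.map (λ {q} → isAnc-∷⇒Below c a (proj₂ q)) (root-image-isAnc (c ∷ a) φ (proj₁ (Equivalence.to T-∧ t)))

count-isBad-branch : ∀ c ys as → IsBranch c ys as → ∀ xs a →
  count (λ φ → isBad (([] , c ∷ a) ∷ φ)) (allMaps xs ys) ≡ count (λ φ → isEmbedding (([] , a) ∷ φ)) (allMaps xs as)
count-isBad-branch c ys as branch xs a =
  trans (count-allMaps-branch c ys as branch xs _ (isBad-below c a))
        (count-cong (λ φ → isBad-underChild c (([] , a) ∷ φ)) (allMaps xs as))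

∑-vertices-bin : ∀ l r (F : Addr → ℕ) → ∑ (vertices (toPTree (bin l r))) F
  ≡ F [] + (∑[ a ∈ vertices (toPTree l) ] F (0 ∷ a) + ∑[ a ∈ vertices (toPTree r) ] F (1 ∷ a))
∑-vertices-bin l r F = cong (F [] +_) (begin
  ∑ (map (0 ∷_) vl ++ (map (1 ∷_) vr ++ [])) F          ≡⟨ ∑-++ F (map (0 ∷_) vl) _ ⟩
  ∑ (map (0 ∷_) vl) F + ∑ (map (1 ∷_) vr ++ []) F       ≡⟨ cong₂ _+_ (∑-map F (0 ∷_) vl) (∑-++ F (map (1 ∷_) vr) []) ⟩
  ∑[ a ∈ vl ] F (0 ∷ a) + (∑ (map (1 ∷_) vr) F + 0)     ≡⟨ cong (∑[ a ∈ vl ] F (0 ∷ a) +_) (trans (+-identityʳ _) (∑-map F (1 ∷_) vr)) ⟩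
  ∑[ a ∈ vl ] F (0 ∷ a) + ∑[ a ∈ vr ] F (1 ∷ a)         ∎)
  where
  open ≡-Reasoning
  vl vr : List Addr
  vl = vertices (toPTree l)
  vr = vertices (toPTree r)

isBranch-left : ∀ l r → IsBranch 0 (vertices (toPTree (bin l r))) (vertices (toPTree l))
isBranch-left l r F vanish = begin
  ∑ (vertices (toPTree (bin l r))) F                                ≡⟨ ∑-vertices-bin l r F ⟩
  F [] + (∑[ a ∈ vertices (toPTree l) ] F (0 ∷ a) + ∑[ a ∈ vertices (toPTree r) ] F (1 ∷ a))
    ≡⟨ cong₂ (λ x y → x + (∑[ a ∈ vertices (toPTree l) ] F (0 ∷ a) + y))
             (vanish [] (λ ())) (∑-zero (λ a → vanish (1 ∷ a) (λ ())) (vertices (toPTree r))) ⟩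
  0 + (∑[ a ∈ vertices (toPTree l) ] F (0 ∷ a) + 0)                 ≡⟨ +-identityʳ _ ⟩
  ∑[ a ∈ vertices (toPTree l) ] F (0 ∷ a)                           ∎
  where open ≡-Reasoning

isBranch-right : ∀ l r → IsBranch 1 (vertices (toPTree (bin l r))) (vertices (toPTree r))
isBranch-right l r F vanish = begin
  ∑ (vertices (toPTree (bin l r))) F                                ≡⟨ ∑-vertices-bin l r F ⟩
  F [] + (∑[ a ∈ vertices (toPTree l) ] F (0 ∷ a) + ∑[ a ∈ vertices (toPTree r) ] F (1 ∷ a))
    ≡⟨ cong₂ (λ x y → x + (y + ∑[ a ∈ vertices (toPTree r) ] F (1 ∷ a)))
             (vanish [] (λ ())) (∑-zero (λ a → vanish (0 ∷ a) (λ ())) (vertices (toPTree l))) ⟩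
  ∑[ a ∈ vertices (toPTree r) ] F (1 ∷ a)                           ∎
  where open ≡-Reasoning

badEmb-leaf : ∀ S → badEmb S (toPTree leaf) ≡ 0
badEmb-leaf (node ts) = trans (count-allMaps-∷ isBad [] (childVerts 0 ts) ([] ∷ []))
  (cong (_+ 0) (count-none isBad-root (allMaps (childVerts 0 ts) ([] ∷ []))))

badEmb-bin : ∀ S l r → badEmb S (toPTree (bin l r)) ≡ emb S (toPTree l) + emb S (toPTree r)
badEmb-bin (node ts) l r = begin
  badEmb (node ts) (toPTree (bin l r))
    ≡⟨ count-allMaps-∷ isBad [] xs ys ⟩
  ∑ ys badRootedAt
    ≡⟨ ∑-vertices-bin l r badRootedAt ⟩
  badRootedAt [] + (∑[ a ∈ vl ] badRootedAt (0 ∷ a) + ∑[ a ∈ vr ] badRootedAt (1 ∷ a))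
    ≡⟨ cong₂ _+_ (count-none isBad-root (allMaps xs ys))
                 (cong₂ _+_ (∑-cong (count-isBad-branch 0 ys vl (isBranch-left l r) xs) vl)
                            (∑-cong (count-isBad-branch 1 ys vr (isBranch-right l r) xs) vr)) ⟩
  ∑[ a ∈ vl ] count (λ φ → isEmbedding (([] , a) ∷ φ)) (allMaps xs vl)
    + ∑[ a ∈ vr ] count (λ φ → isEmbedding (([] , a) ∷ φ)) (allMaps xs vr)
    ≡⟨ cong₂ _+_ (count-allMaps-∷ isEmbedding [] xs vl) (count-allMaps-∷ isEmbedding [] xs vr) ⟨
  emb (node ts) (toPTree l) + emb (node ts) (toPTree r)
    ∎
  where
  open ≡-Reasoning
  xs ys vl vr : List Addr
  xs = childVerts 0 ts
  ys = vertices (toPTree (bin l r))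
  vl = vertices (toPTree l)
  vr = vertices (toPTree r)
  badRootedAt : Addr → ℕ
  badRootedAt y = count (λ φ → isBad (([] , y) ∷ φ)) (allMaps xs ys)

zBA-suc : ∀ S m → zBA S (suc m) ≡ ∑[ i ∈ upTo (suc m) ] b i * a𝓑 S (m ∸ i)
zBA-suc S m = ∑-upTo-suc (λ k → zB k * a𝓑 S (suc m ∸ k)) (suc m)

∑-badEmb-𝓑 : ∀ S m → ∑[ t ∈ 𝓑 (suc m) ] badEmb S (toPTree t) ≡ 2 * zBA S (suc m)
∑-badEmb-𝓑 S m = begin
  ∑[ t ∈ 𝓑 (suc m) ] bad t
    ≡⟨ ∑-𝓑-suc m bad ⟩
  (if 1 ≡ᵇ suc m then bad leaf else 0) + ∑[ i ∈ upTo (suc m) ] ∑[ l ∈ 𝓑 i ] ∑[ r ∈ 𝓑 (m ∸ i) ] bad (bin l r)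
    ≡⟨ cong₂ _+_ (trans (cong (if 1 ≡ᵇ suc m then_else 0) (badEmb-leaf S)) (if-eta (1 ≡ᵇ suc m)))
                 (∑-cong (λ i → ∑-cong (λ l → ∑-cong (badEmb-bin S l) (𝓑 (m ∸ i))) (𝓑 i)) (upTo (suc m))) ⟩
  ∑[ i ∈ upTo (suc m) ] ∑[ l ∈ 𝓑 i ] ∑[ r ∈ 𝓑 (m ∸ i) ] (e l + e r)
    ≡⟨ ∑-cong (λ i → ∑∑-+ e e (𝓑 i) (𝓑 (m ∸ i))) (upTo (suc m)) ⟩
  ∑[ i ∈ upTo (suc m) ] (b (m ∸ i) * a𝓑 S i + b i * a𝓑 S (m ∸ i))
    ≡⟨ ∑-+ (λ i → b (m ∸ i) * a𝓑 S i) (λ i → b i * a𝓑 S (m ∸ i)) (upTo (suc m)) ⟩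
  ∑[ i ∈ upTo (suc m) ] b (m ∸ i) * a𝓑 S i + ∑[ i ∈ upTo (suc m) ] b i * a𝓑 S (m ∸ i)
    ≡⟨ cong (_+ ∑[ i ∈ upTo (suc m) ] b i * a𝓑 S (m ∸ i)) reverse ⟩
  ∑[ i ∈ upTo (suc m) ] b i * a𝓑 S (m ∸ i) + ∑[ i ∈ upTo (suc m) ] b i * a𝓑 S (m ∸ i)
    ≡⟨ cong (λ x → x + x) (zBA-suc S m) ⟨
  zBA S (suc m) + zBA S (suc m)
    ≡⟨ cong (zBA S (suc m) +_) (+-identityʳ (zBA S (suc m))) ⟨
  2 * zBA S (suc m)
    ∎
  where
  open ≡-Reasoning
  e bad : BTree → ℕ
  e t   = emb S (toPTree t)
  bad t = badEmb S (toPTree t)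
  reverse : ∑[ i ∈ upTo (suc m) ] b (m ∸ i) * a𝓑 S i ≡ ∑[ i ∈ upTo (suc m) ] b i * a𝓑 S (m ∸ i)
  reverse = trans (∑-upTo-cong (suc m) (λ { i (s≤s i≤m) → cong (λ k → b (m ∸ i) * a𝓑 S k) (sym (m∸[m∸n]≡n i≤m)) }))
                  (∑-upTo-reverse m (λ j → b j * a𝓑 S (m ∸ j)))

mainTheorem2 : (S : PTree) (n : ℕ) → g𝓑 S n + 2 * zBA S n ≡ a𝓑 S n
mainTheorem2 S zero    = refl
mainTheorem2 S (suc m) = begin
  g𝓑 S (suc m) + 2 * zBA S (suc m)
    ≡⟨ cong (g𝓑 S (suc m) +_) (∑-badEmb-𝓑 S m) ⟨
  g𝓑 S (suc m) + ∑[ t ∈ 𝓑 (suc m) ] badEmb S (toPTree t)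
    ≡⟨ ∑-+ (λ t → goodEmb S (toPTree t)) (λ t → badEmb S (toPTree t)) (𝓑 (suc m)) ⟨
  ∑[ t ∈ 𝓑 (suc m) ] (goodEmb S (toPTree t) + badEmb S (toPTree t))
    ≡⟨ ∑-cong (λ t → emb≡goodEmb+badEmb S (toPTree t)) (𝓑 (suc m)) ⟨
  a𝓑 S (suc m)
    ∎
  where open ≡-Reasoning
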